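{- Let $H$ be a hypergraph and let $v$ be a vertex of $H$ that is not isolated and not contained in any induced Berge cycle of length $3$. Let $e_1, \ldots, e_k$ be the edges of $H$ containing $v$ and $\tilde{e}_i = e_i \setminus \{v\}$. Let $K = \mathrm{st}(v) \cap \bigcup_{i=1}^k \mathrm{st}(\tilde{e}_i)$ (stars taken in $I(H)$), regarded as a complex on $V(H) \setminus \{v\}$, and let $H_v$ be the set of missing faces of $K$, i.e. the inclusion-minimal subsets of $V(H)\setminus\{v\}$ not belonging to $K$. Then $\tilde{e}_1, \ldots, \tilde{e}_k \in H_v$. Moreover, for a set $f$, we have $f \in H_v \setminus \{\tilde{e}_1, \ldots, \tilde{e}_k\}$ if and only if $\tilde{e}_i \not\subseteq f$ for all $i \in \{1,\ldots,k\}$ and the following hold: (i) for each $i \in \{1,\ldots,k\}$ there is an edge $h_i \in H \setminus \{e_1, \ldots, e_k\}$ with $h_i \subseteq f \cup e_i$; and (ii) $f$ is inclusion-minimal subject to (i).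
   Context: A hypergraph $H$ on a finite set $V=V(H)$ is a collection of nonempty subsets of $V$, called edges. Standing convention: every edge of $H$ is inclusion-minimal (no edge properly contains another edge) and has size at least $2$. An independent set of $H$ is a subset of $V(H)$ containing no edge of $H$; the independence complex $I(H)$ is the simplicial complex of all independent sets. A vertex is isolated if it lies in no edge. A Berge cycle of length $k$ in $H$ is an alternating sequence $v_1 e_1 \cdots v_k e_k$ of $k$ distinct vertices and $k$ distinct edges with $v_i, v_{i+1} \in e_i$ (indices mod $k$); it is induced if $e_i \cap \{v_1,\ldots,v_k\} = \{v_i,v_{i+1}\}$ for all $i$ and no edge contains two non-consecutive vertices of the cycle. For a simplicial complex $X$ on $V$ and $\sigma \in X$, $\mathrm{st}_X(\sigma) = \{\tau \subseteq V : \tau \cup \sigma \in X\}$. -}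

module Defs where

open import Data.Nat using (ℕ; _≤_)
open import Data.Fin using (Fin)
open import Data.Fin.Subset using (Subset; _∈_; _∉_; _⊆_; _⊂_; _∪_; _-_; ⁅_⁆; ∣_∣)
open import Data.List using (List)
import Data.List.Membership.Propositional as LM
open import Data.List.Relation.Unary.Unique.Propositional using (Unique)
open import Data.Product using (_×_; Σ; ∃; ∃-syntax; _,_)
open import Data.Sum using (_⊎_)
open import Relation.Nullary using (¬_)
open import Relation.Binary.PropositionalEquality using (_≡_; _≢_)

_∈ₑ_ : ∀ {n} → Subset n → List (Subset n) → Set
e ∈ₑ E = e LM.∈ E

record Hypergraph (n : ℕ) : Set where
  field
    edges    : List (Subset n)
    distinct : Unique edges
    size≥2   : ∀ e → e ∈ₑ edges → 2 ≤ ∣ e ∣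
    minimal  : ∀ e e′ → e ∈ₑ edges → e′ ∈ₑ edges → e ⊆ e′ → e ≡ e′
open Hypergraph public

module _ {n : ℕ} (H : Hypergraph n) where

  Independent : Subset n → Set
  Independent σ = ∀ e → e ∈ₑ edges H → ¬ (e ⊆ σ)

  InStar : Subset n → Subset n → Set
  InStar σ τ = Independent (τ ∪ σ)

  Isolated : Fin n → Set
  Isolated v = ∀ e → e ∈ₑ edges H → v ∉ e

  -- an induced Berge cycle v₁ e₁ v₂ e₂ v₃ e₃ of length 3
  -- (for length 3 all pairs of cycle vertices are consecutive, so the
  --  "no edge contains two non-consecutive vertices" condition is vacuous)
  record InducedBerge3 : Set where
    field
      v₁ v₂ v₃ : Fin n
      e₁ e₂ e₃ : Subset n
      v₁≢v₂ : v₁ ≢ v₂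
      v₂≢v₃ : v₂ ≢ v₃
      v₁≢v₃ : v₁ ≢ v₃
      e₁≢e₂ : e₁ ≢ e₂
      e₂≢e₃ : e₂ ≢ e₃
      e₁≢e₃ : e₁ ≢ e₃
      e₁∈H : e₁ ∈ₑ edges H
      e₂∈H : e₂ ∈ₑ edges H
      e₃∈H : e₃ ∈ₑ edges H
      v₁∈e₁ : v₁ ∈ e₁
      v₂∈e₁ : v₂ ∈ e₁
      v₂∈e₂ : v₂ ∈ e₂
      v₃∈e₂ : v₃ ∈ e₂
      v₃∈e₃ : v₃ ∈ e₃
      v₁∈e₃ : v₁ ∈ e₃
      -- induced: e_i ∩ {v₁,v₂,v₃} = {v_i, v_{i+1}}
      v₃∉e₁ : v₃ ∉ e₁
      v₁∉e₂ : v₁ ∉ e₂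
      v₂∉e₃ : v₂ ∉ e₃

  OnCycle : Fin n → InducedBerge3 → Set
  OnCycle v C = v ≡ InducedBerge3.v₁ C ⊎ v ≡ InducedBerge3.v₂ C ⊎ v ≡ InducedBerge3.v₃ C

  EdgeAt : Fin n → Subset n → Set
  EdgeAt v e = e ∈ₑ edges H × v ∈ e

  K : Fin n → Subset n → Set
  K v τ = InStar ⁅ v ⁆ τ × ∃[ e ] (EdgeAt v e × InStar (e - v) τ)

  Hv : Fin n → Subset n → Set
  Hv v f = v ∉ f × ¬ K v f × (∀ g → g ⊂ f → K v g)

  Cond-i : Fin n → Subset n → Set
  Cond-i v f = ∀ e → EdgeAt v e →
    ∃[ h ] (h ∈ₑ edges H × ¬ EdgeAt v h × h ⊆ f ∪ e)

  MinCond-i : Fin n → Subset n → Set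
  MinCond-i v f = Cond-i v f × (∀ g → g ⊂ f → ¬ Cond-i v g)

{-# OPTIONS --safe #-}
-- For v ∉ g, the two stars defining K can be read off the edges of H:
-- g ∪ {v} is independent iff g contains no ẽᵢ and no edge avoiding v, and
-- g ∪ ẽᵢ is independent iff no edge avoiding v lies in g ∪ eᵢ.  Since an
-- edge avoiding v inside g lies in every g ∪ eᵢ, this gives
--   g ∈ K  ⇔  no ẽᵢ ⊆ g  and  g violates (i).
-- Each ẽᵢ is a missing face because the edges of H form an antichain.  A
-- missing face f other than the ẽᵢ contains no ẽᵢ (that would be a proper
-- subset, hence a face, while ẽᵢ is not), so f ∉ K means that f satisfies
-- (i) and minimality as a non-face is minimality subject to (i).
module Submission where

open import Defs
open import Data.Nat using (ℕ)
open import Data.Fin using (Fin)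
open import Data.Fin.Properties using (_≟_; ¬∀⟶∃¬)
open import Data.Fin.Subset using (Subset; _⊆_; _⊂_; _∈_; _∉_; _∪_; _─_; _-_; ⁅_⁆; outside)
open import Data.Fin.Subset.Properties
  using ( _∈?_; _⊆?_; x∈p∪q⁻; x∈p∪q⁺; p⊆p∪q; p─q⊆p; x∈p∧x≢y⇒x∈p-y; x∈p⇒p-x⊂p
        ; x∈⁅x⁆; x∈⁅y⁆⇒x≡y; x∉⁅y⁆⇒x≢y
        ; ⊆-refl; ⊆-trans; ⊆-reflexive; ⊆-antisym; ⊆-⊂-trans; ⊂-irref; p⊂q⇒p⊆q )
open import Data.List using (List)
open import Data.List.Relation.Unary.Any using (any?)
open import Data.List.Membership.Propositional using (find; lose) renaming (_∈_ to _∈ˡ_)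
open import Data.Vec using (_∷_; here; there)
open import Data.Product using (_×_; ∃-syntax; _,_; proj₁; proj₂)
open import Data.Sum using (_⊎_; inj₁; inj₂; [_,_]′)
open import Data.Empty using (⊥-elim)
open import Function using (_∘_; id)
open import Function.Bundles using (_⇔_; mk⇔)
open import Relation.Nullary using (¬_; Dec; yes; no)
open import Relation.Nullary.Decidable using (_×-dec_; _→-dec_; decidable-stable)
open import Relation.Unary using (Decidable)
open import Relation.Binary.PropositionalEquality using (_≡_; _≢_; refl; sym; subst)

∃∈-or-∀∈¬ : ∀ {a p} {A : Set a} {P : A → Set p} → Decidable P → (xs : List A) →
            ∃[ x ] (x ∈ˡ xs × P x) ⊎ (∀ x → x ∈ˡ xs → ¬ P x)
∃∈-or-∀∈¬ P? xs with any? P? xs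
... | yes some = inj₁ (find some)
... | no none  = inj₂ λ x x∈xs px → none (lose x∈xs px)

x∈p─q⇒x∉q : ∀ {n} (p q : Subset n) {x} → x ∈ p ─ q → x ∉ q
x∈p─q⇒x∉q (s ∷ p) (outside ∷ q) here       ()
x∈p─q⇒x∉q (s ∷ p) (t ∷ q)       (there x∈) (there x∈q) = x∈p─q⇒x∉q p q x∈ x∈q

module _ {n : ℕ} where

  x∈p-y⇒x≢y : ∀ {p : Subset n} {x y} → x ∈ p - y → x ≢ y
  x∈p-y⇒x≢y {p} {y = y} = x∉⁅y⁆⇒x≢y ∘ x∈p─q⇒x∉q p ⁅ y ⁆

  x∉p⇒p⊆p-x : ∀ {p : Subset n} {x} → x ∉ p → p ⊆ p - x
  x∉p⇒p⊆p-x x∉p y∈p = x∈p∧x≢y⇒x∈p-y y∈p λ { refl → x∉p y∈p }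

  x∉p⇒x∉p∪q-x : ∀ {p : Subset n} {x} q → x ∉ p → x ∉ p ∪ (q - x)
  x∉p⇒x∉p∪q-x {p} {x} q x∉p x∈ = [ x∉p , (λ x∈q-x → x∈p-y⇒x≢y x∈q-x refl) ]′ (x∈p∪q⁻ p (q - x) x∈)

  p-x⊆q⇒p⊆q∪⁅x⁆ : ∀ {p q : Subset n} {x} → p - x ⊆ q → p ⊆ q ∪ ⁅ x ⁆
  p-x⊆q⇒p⊆q∪⁅x⁆ {x = x} p-x⊆q {y} y∈p with y ≟ x
  ... | yes refl = x∈p∪q⁺ (inj₂ (x∈⁅x⁆ x))
  ... | no  y≢x  = x∈p∪q⁺ (inj₁ (p-x⊆q (x∈p∧x≢y⇒x∈p-y y∈p y≢x)))

  p⊆q∪⁅x⁆⇒p-x⊆q : ∀ {p q : Subset n} {x} → p ⊆ q ∪ ⁅ x ⁆ → p - x ⊆ q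
  p⊆q∪⁅x⁆⇒p-x⊆q {p} {q} {x} p⊆ y∈p-x with x∈p∪q⁻ q ⁅ x ⁆ (p⊆ (p─q⊆p p ⁅ x ⁆ y∈p-x))
  ... | inj₁ y∈q  = y∈q
  ... | inj₂ y∈⁅x⁆ = ⊥-elim (x∈p-y⇒x≢y y∈p-x (x∈⁅y⁆⇒x≡y x y∈⁅x⁆))

  x∈q∧p-x⊆q⇒p⊆q : ∀ {p q : Subset n} {x} → x ∈ q → p - x ⊆ q → p ⊆ q
  x∈q∧p-x⊆q⇒p⊆q {q = q} {x} x∈q p-x⊆q y∈p with x∈p∪q⁻ q ⁅ x ⁆ (p-x⊆q⇒p⊆q∪⁅x⁆ p-x⊆q y∈p)
  ... | inj₁ y∈q   = y∈q
  ... | inj₂ y∈⁅x⁆ = subst (_∈ q) (sym (x∈⁅y⁆⇒x≡y x y∈⁅x⁆)) x∈q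

  ∪-lub : ∀ {p q r : Subset n} → p ⊆ r → q ⊆ r → p ∪ q ⊆ r
  ∪-lub {p} {q} p⊆r q⊆r x∈ = [ p⊆r , q⊆r ]′ (x∈p∪q⁻ p q x∈)

  p∪q-x⊆p∪q : ∀ (p q : Subset n) {x} → p ∪ (q - x) ⊆ p ∪ q
  p∪q-x⊆p∪q p q {x} = ∪-lub (p⊆p∪q q) (λ y∈ → x∈p∪q⁺ (inj₂ (p─q⊆p q ⁅ x ⁆ y∈)))

  x∉p∧p⊆q∪r⇒p⊆q∪r-x : ∀ {p q r : Subset n} {x} → x ∉ p → p ⊆ q ∪ r → p ⊆ q ∪ (r - x)
  x∉p∧p⊆q∪r⇒p⊆q∪r-x {q = q} {r} x∉p p⊆ y∈p with x∈p∪q⁻ q r (p⊆ y∈p)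
  ... | inj₁ y∈q = x∈p∪q⁺ (inj₁ y∈q)
  ... | inj₂ y∈r = x∈p∪q⁺ (inj₂ (x∈p∧x≢y⇒x∈p-y y∈r λ { refl → x∉p y∈p }))

  x∉p∧p⊆q∪r⇒p⊆q-x∪r : ∀ {p q r : Subset n} {x} → x ∉ p → p ⊆ q ∪ r → p ⊆ (q - x) ∪ r
  x∉p∧p⊆q∪r⇒p⊆q-x∪r {q = q} {r} x∉p p⊆ y∈p with x∈p∪q⁻ q r (p⊆ y∈p)
  ... | inj₁ y∈q = x∈p∪q⁺ (inj₁ (x∈p∧x≢y⇒x∈p-y y∈q λ { refl → x∉p y∈p }))
  ... | inj₂ y∈r = x∈p∪q⁺ (inj₂ y∈r)

  ⊆∧≢⇒⊂ : ∀ {p q : Subset n} → p ⊆ q → p ≢ q → p ⊂ q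
  ⊆∧≢⇒⊂ {p} {q} p⊆q p≢q
    with ¬∀⟶∃¬ n (λ x → x ∈ q → x ∈ p) (λ x → (x ∈? q) →-dec (x ∈? p))
                 (λ q⊆p → p≢q (⊆-antisym p⊆q (q⊆p _)))
  ... | x , q⊈p = p⊆q , x , decidable-stable (x ∈? q) (λ x∉q → q⊈p (⊥-elim ∘ x∉q))
                          , (λ x∈p → q⊈p (λ _ → x∈p))

module _ {n : ℕ} (H : Hypergraph n) where

  independent-⊆ : ∀ {σ τ} → σ ⊆ τ → Independent H τ → Independent H σ
  independent-⊆ σ⊆τ ind h h∈H h⊆σ = ind h h∈H (⊆-trans h⊆σ σ⊆τ)

  dependent⊎independent : ∀ σ → ∃[ h ] (h ∈ₑ edges H × h ⊆ σ) ⊎ Independent H σ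
  dependent⊎independent σ = ∃∈-or-∀∈¬ (_⊆? σ) (edges H)

  independent? : ∀ σ → Dec (Independent H σ)
  independent? σ with dependent⊎independent σ
  ... | inj₁ (h , h∈H , h⊆σ) = no λ ind → ind h h∈H h⊆σ
  ... | inj₂ ind             = yes ind

module _ {n : ℕ} (H : Hypergraph n) (v : Fin n) where

  NoẽIn : Subset n → Set
  NoẽIn g = ∀ e → EdgeAt H v e → ¬ (e - v ⊆ g)

  NoẽIn-antitone : ∀ {f g} → g ⊆ f → NoẽIn f → NoẽIn g
  NoẽIn-antitone g⊆f noẽ e at ẽ⊆g = noẽ e at (⊆-trans ẽ⊆g g⊆f)

  v∉ẽ : ∀ e → v ∉ e - v
  v∉ẽ e v∈ = x∈p-y⇒x≢y v∈ refl

  K⇒NoẽIn : ∀ {g} → K H v g → NoẽIn g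
  K⇒NoẽIn (ind , _) e (e∈H , _) ẽ⊆g = ind e e∈H (p-x⊆q⇒p⊆q∪⁅x⁆ ẽ⊆g)

  Cond-i⇒¬K : ∀ {g} → Cond-i H v g → ¬ K H v g
  Cond-i⇒¬K c (_ , e , at , ind) =
    let h , h∈H , h∉at , h⊆g∪e = c e at
    in ind h h∈H (x∉p∧p⊆q∪r⇒p⊆q∪r-x (h∉at ∘ (h∈H ,_)) h⊆g∪e)

  Cond-i-without-v : ∀ {g} → Cond-i H v g → Cond-i H v (g - v)
  Cond-i-without-v c e at =
    let h , h∈H , h∉at , h⊆g∪e = c e at
    in h , h∈H , h∉at , x∉p∧p⊆q∪r⇒p⊆q-x∪r (h∉at ∘ (h∈H ,_)) h⊆g∪e

  inStar-v : ∀ {g} → NoẽIn g → Independent H g → InStar H ⁅ v ⁆ g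
  inStar-v noẽ ind h h∈H h⊆g∪v with v ∈? h
  ... | yes v∈h = noẽ h (h∈H , v∈h) (p⊆q∪⁅x⁆⇒p-x⊆q h⊆g∪v)
  ... | no  v∉h = ind h h∈H (⊆-trans (x∉p⇒p⊆p-x v∉h) (p⊆q∪⁅x⁆⇒p-x⊆q h⊆g∪v))

  Cond-i⊎K : ∀ {g} → v ∉ g → NoẽIn g → Cond-i H v g ⊎ K H v g
  Cond-i⊎K {g} v∉g noẽ with ∃∈-or-∀∈¬ (λ e → (v ∈? e) ×-dec independent? H (g ∪ (e - v))) (edges H)
  ... | inj₁ (e , e∈H , v∈e , ind) =
    inj₂ (inStar-v noẽ (independent-⊆ H (p⊆p∪q _) ind) , e , (e∈H , v∈e) , ind)
  ... | inj₂ none                  = inj₁ λ e (e∈H , v∈e) → blocker e e∈H v∈e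
    where
    blocker : ∀ e → e ∈ₑ edges H → v ∈ e → ∃[ h ] (h ∈ₑ edges H × ¬ EdgeAt H v h × h ⊆ g ∪ e)
    blocker e e∈H v∈e with dependent⊎independent H (g ∪ (e - v))
    ... | inj₁ (h , h∈H , h⊆) =
      h , h∈H , (λ (_ , v∈h) → x∉p⇒x∉p∪q-x e v∉g (h⊆ v∈h)) , ⊆-trans h⊆ (p∪q-x⊆p∪q g e)
    ... | inj₂ ind            = ⊥-elim (none e e∈H (v∈e , ind))

  NoẽIn∧¬Cond-i⇒K : ∀ {g} → v ∉ g → NoẽIn g → ¬ Cond-i H v g → K H v g
  NoẽIn∧¬Cond-i⇒K v∉g noẽ ¬c = [ ⊥-elim ∘ ¬c , id ]′ (Cond-i⊎K v∉g noẽ)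

  ẽ∈Hv : ∀ e → EdgeAt H v e → Hv H v (e - v)
  ẽ∈Hv e at@(e∈H , v∈e) = v∉ẽ e , (λ k → K⇒NoẽIn k e at ⊆-refl) , faces
    where
    faces : ∀ g → g ⊂ e - v → K H v g
    faces g g⊂ẽ@(g⊆ẽ , _) = NoẽIn∧¬Cond-i⇒K (v∉ẽ e ∘ g⊆ẽ) noẽ ¬c
      where
      g⊆e : g ⊆ e
      g⊆e = ⊆-trans g⊆ẽ (p─q⊆p e ⁅ v ⁆)
      noẽ : NoẽIn g
      noẽ e′ (e′∈H , _) ẽ′⊆g = ⊂-irref refl (⊆-⊂-trans (subst (λ d → d - v ⊆ g) e′≡e ẽ′⊆g) g⊂ẽ)
        where
        e′≡e : e′ ≡ e
        e′≡e = minimal H e′ e e′∈H e∈H (x∈q∧p-x⊆q⇒p⊆q v∈e (⊆-trans ẽ′⊆g g⊆e))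
      ¬c : ¬ Cond-i H v g
      ¬c c = let h , h∈H , h∉at , h⊆g∪e = c e at
                 h≡e = minimal H h e h∈H e∈H (⊆-trans h⊆g∪e (∪-lub g⊆e ⊆-refl))
             in h∉at (subst (EdgeAt H v) (sym h≡e) at)

  Hv∖ẽ⇒MinCond-i : ∀ {f} → Hv H v f × (∀ e → EdgeAt H v e → f ≢ e - v) →
                   NoẽIn f × MinCond-i H v f
  Hv∖ẽ⇒MinCond-i {f} ((v∉f , ¬Kf , faces) , f≢ẽ) =
    noẽ , [ id , ⊥-elim ∘ ¬Kf ]′ (Cond-i⊎K v∉f noẽ) , λ g g⊂f c → Cond-i⇒¬K c (faces g g⊂f)
    where
    noẽ : NoẽIn f
    noẽ e at ẽ⊆f = proj₁ (proj₂ (ẽ∈Hv e at)) (faces (e - v) (⊆∧≢⇒⊂ ẽ⊆f (f≢ẽ e at ∘ sym)))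

  MinCond-i⇒Hv∖ẽ : ∀ {f} → NoẽIn f × MinCond-i H v f →
                   Hv H v f × (∀ e → EdgeAt H v e → f ≢ e - v)
  MinCond-i⇒Hv∖ẽ {f} (noẽ , c , minimal-c) =
    (v∉f , Cond-i⇒¬K c , faces) , λ e at f≡ẽ → noẽ e at (⊆-reflexive (sym f≡ẽ))
    where
    v∉f : v ∉ f
    v∉f v∈f = minimal-c (f - v) (x∈p⇒p-x⊂p v∈f) (Cond-i-without-v c)
    faces : ∀ g → g ⊂ f → K H v g
    faces g g⊂f = let g⊆f = p⊂q⇒p⊆q g⊂f
                  in NoẽIn∧¬Cond-i⇒K (v∉f ∘ g⊆f) (NoẽIn-antitone g⊆f noẽ) (minimal-c g g⊂f)

theorem4p1 : ∀ {n} (H : Hypergraph n) (v : Fin n) →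
    ∃[ e ] EdgeAt H v e →
    (∀ (C : InducedBerge3 H) → ¬ OnCycle H v C) →
    (∀ e → EdgeAt H v e → Hv H v (e - v)) ×
    (∀ (f : Subset n) →
      (Hv H v f × (∀ e → EdgeAt H v e → f ≢ e - v)) ⇔
      ((∀ e → EdgeAt H v e → ¬ (e - v ⊆ f)) × MinCond-i H v f))
theorem4p1 H v _ _ = ẽ∈Hv H v , λ f → mk⇔ (Hv∖ẽ⇒MinCond-i H v) (MinCond-i⇒Hv∖ẽ H v)
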